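{- Let $A$ be a finite alphabet with $|A| = a \ge 2$, let $n$ be a positive integer and $k$ an integer with $2 \le k \le n/2$. There does not exist a universal partial word for $A^n$ of the form $w = u\diamond^k v$, where $u$ and $v$ are (possibly empty) words over $A$ (containing no $\diamond$).
   Context: A partial word over $A$ is a finite sequence of characters from $A \cup \{\diamond\}$, where $\diamond \notin A$ is a wild-card symbol; a word over $A$ contains no $\diamond$. $A^n$ denotes the set of words of length $n$ over $A$. For $x = x_1\cdots x_n \in A^n$ and a partial word $w = w_1\cdots w_N$, the position $i$ ($0 \le i \le N-n$) covers $x$ if $x_j = w_{i+j}$ for every $1\le j\le n$ with $w_{i+j}\in A$. A universal partial word for $A^n$ is a partial word $w$ such that every word in $A^n$ is covered by exactly one position of $w$. $\diamond^k$ denotes $k$ consecutive $\diamond$'s. -}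

module Defs where

open import Data.Nat using (ℕ; zero; suc)
open import Data.List using (List; []; _∷_; drop; _++_; replicate; map; length)
open import Data.Maybe using (Maybe; just; nothing)
open import Data.Product using (∃; _×_; _,_)
open import Relation.Binary.PropositionalEquality using (_≡_)

-- A partial word over A: list over A ∪ {◇}, with ◇ encoded as nothing.
PartialWord : Set → Set
PartialWord A = List (Maybe A)

hole : {A : Set} → Maybe A
hole = nothing

fromWord : {A : Set} → List A → PartialWord A
fromWord = map just

data LetterCovers {A : Set} : Maybe A → A → Set where
  ◇-covers   : ∀ {c} → LetterCovers nothing c
  eq-covers  : ∀ {c} → LetterCovers (just c) c

data PrefixCovers {A : Set} : PartialWord A → List A → Set where
  []-cov : ∀ {p} → PrefixCovers p []
  ∷-cov  : ∀ {c p x xs} → LetterCovers c x → PrefixCovers p xs →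
           PrefixCovers (c ∷ p) (x ∷ xs)

Covers : {A : Set} → PartialWord A → ℕ → List A → Set
Covers w i x = PrefixCovers (drop i w) x

IsUniversal : (A : Set) → ℕ → PartialWord A → Set
IsUniversal A n w =
  (x : List A) → length x ≡ n →
  ∃ λ i → Covers w i x × ((j : ℕ) → Covers w j x → j ≡ i)

-- If x is covered at a position i that is not the last one, dropping the first letter of x and
-- appending the letter of w at i + n gives a word covered at i + 1; if that word also fits a
-- window b whose last position is a hole, uniqueness forces i + 1 = b.  Let b be the window
-- ending at the last hole of ◇^k (it exists when n ≤ |u| + k) and probe with the word that copies
-- this window, holes filled arbitrarily, preceded by a letter that differs from w at b - 1.  It is
-- not covered at b - 1, hence only at the last window: then either the last letter of v is
-- contradicted (fill the holes with a letter differing from it), or v is empty, the last window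
-- is b itself, and a second probe at b - 1 contradicts the first.  When n ≤ |v| + k the same
-- argument applies to the reversed word; otherwise the letter of u (or v) next to the block lies
-- in every window, and a constant word avoiding it is not covered.
module Submission where

open import Defs
open import Data.Nat using (ℕ; zero; suc; pred; _+_; _∸_; _*_; _≤_; _<_; z≤n; s≤s; _≤?_)
open import Data.Nat.Properties
open import Data.Fin using (Fin) renaming (zero to fzero; suc to fsuc)
open import Data.List using (List; []; _∷_; _++_; replicate; length; applyUpTo)
open import Data.List.Properties using (length-applyUpTo; length-++; length-map; length-replicate)
open import Data.Maybe using (Maybe; just; nothing; fromMaybe)
open import Data.Product using (∃; _×_; _,_; proj₁; proj₂)
open import Data.Sum using (inj₁; inj₂)
open import Data.Empty using (⊥; ⊥-elim)
open import Function using (_∘_)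
open import Relation.Nullary using (¬_; yes; no)
open import Relation.Binary.PropositionalEquality

private
  variable
    A : Set
    a b c d i j k m n p q t N : ℕ

+-suc-cancel : a + suc b ≡ c + suc d → a + b ≡ c + d
+-suc-cancel {a} {b} {c} {d} eq = suc-injective (trans (sym (+-suc a b)) (trans eq (+-suc c d)))

mirror : ℕ → ℕ → ℕ
mirror N j = N ∸ suc j

mirror-< : j < N → mirror N j < N
mirror-< {j} {suc N} _ = s≤s (m∸n≤m N j)

mirror-involutive : j < N → mirror N (mirror N j) ≡ j
mirror-involutive (s≤s j≤N) = m∸[m∸n]≡n j≤N

mirror-+ : ∀ a → j < b → mirror (a + b) j ≡ a + mirror b j
mirror-+ a j<b = +-∸-assoc a j<b

mirror-cancelˡ : ∀ a b j → mirror (a + b) (a + j) ≡ mirror b j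
mirror-cancelˡ a b j = trans (cong (a + b ∸_) (sym (+-suc a j))) ([m+n]∸[m+o]≡n∸o a b (suc j))

mirror-window : i + n ≤ N → j < n → mirror N (N ∸ (i + n) + j) ≡ i + mirror n j
mirror-window {i} {n} {N} {j} i+n≤N j<n = begin
  mirror N (s + j)             ≡⟨ cong (λ M → mirror M (s + j)) (sym (m∸n+n≡m i+n≤N)) ⟩
  mirror (s + (i + n)) (s + j) ≡⟨ mirror-cancelˡ s (i + n) j ⟩
  mirror (i + n) j             ≡⟨ mirror-+ i j<n ⟩
  i + mirror n j               ∎
  where
    open ≡-Reasoning
    s = N ∸ (i + n)

just-covers : ∀ {c d : A} → LetterCovers (just c) d → c ≡ d
just-covers eq-covers = refl

covers-fromMaybe : ∀ (l : Maybe A) {c} → LetterCovers l (fromMaybe c l)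
covers-fromMaybe (just _) = eq-covers
covers-fromMaybe nothing  = ◇-covers

fromMaybe-covered : ∀ {l : Maybe A} {c} → LetterCovers l c → fromMaybe c l ≡ c
fromMaybe-covered ◇-covers  = refl
fromMaybe-covered eq-covers = refl

CoversAt : (ℕ → Maybe A) → ℕ → ℕ → ℕ → (ℕ → A) → Set
CoversAt w N n i x = i + n ≤ N × (∀ j → j < n → LetterCovers (w (i + j)) (x j))

record Universal (w : ℕ → Maybe A) (N n : ℕ) : Set where
  field
    cover  : ∀ x → ∃ λ i → CoversAt w N n i x
    unique : ∀ {x i i′} → CoversAt w N n i x → CoversAt w N n i′ x → i ≡ i′

coversAt-congʳ : ∀ {w : ℕ → Maybe A} {x y} → (∀ {j} → j < n → x j ≡ y j) →
                 CoversAt w N n i x → CoversAt w N n i y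
coversAt-congʳ x≗y (bound , fits) = bound , λ j j<n → subst (LetterCovers _) (x≗y j<n) (fits j j<n)

coversAt-congˡ : ∀ {w w′ : ℕ → Maybe A} {x} → (∀ {j} → j < N → w j ≡ w′ j) →
                 CoversAt w N n i x → CoversAt w′ N n i x
coversAt-congˡ {i = i} w≗w′ (bound , fits) = bound , λ j j<n →
  subst (λ l → LetterCovers l _) (w≗w′ (<-≤-trans (+-monoʳ-< i j<n) bound)) (fits j j<n)

tail-fits⇒next-window : ∀ {w : ℕ → Maybe A} {x} → Universal w N (suc m) →
  b + suc m ≤ N → w (b + m) ≡ nothing → (∀ j → j < m → LetterCovers (w (b + j)) (x (suc j))) →
  CoversAt w N (suc m) i x → suc i + suc m ≤ N → suc i ≡ b
tail-fits⇒next-window {N = N} {m} {b} {i} {w} {x} U b-bound b+m-hole tail-fits (_ , fits) next-bound =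
  Universal.unique U {x = y} (next-bound , λ j _ → covers-fromMaybe (w (suc i + j))) (b-bound , fits-b)
  where
    y : ℕ → _
    y j = fromMaybe (x (suc j)) (w (suc i + j))

    fits-b : ∀ j → j < suc m → LetterCovers (w (b + j)) (y j)
    fits-b j j<1+m with m<1+n⇒m<n∨m≡n j<1+m
    ... | inj₁ j<m = subst (LetterCovers (w (b + j))) (sym (fromMaybe-covered fits-next)) (tail-fits j j<m)
      where
        fits-next : LetterCovers (w (suc i + j)) (x (suc j))
        fits-next = subst (λ l → LetterCovers (w l) (x (suc j))) (+-suc i j) (fits (suc j) (s≤s j<m))
    ... | inj₂ refl = subst (λ l → LetterCovers l (y m)) (sym b+m-hole) ◇-covers

coversAt-mirror : ∀ {w : ℕ → Maybe A} {x} → CoversAt w N n i x →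
                  CoversAt (w ∘ mirror N) N n (N ∸ (i + n)) (x ∘ mirror n)
coversAt-mirror {N = N} {n} {i} {w} {x} (bound , fits) = mirrored-bound , λ j j<n →
  subst (λ l → LetterCovers (w l) (x (mirror n j))) (sym (mirror-window bound j<n))
        (fits (mirror n j) (mirror-< j<n))
  where
    mirrored-bound : N ∸ (i + n) + n ≤ N
    mirrored-bound = ≤-trans (+-monoʳ-≤ (N ∸ (i + n)) (m≤n+m n i)) (≤-reflexive (m∸n+n≡m bound))

universal-mirror : ∀ {w : ℕ → Maybe A} → Universal w N n → Universal (w ∘ mirror N) N n
universal-mirror {N = N} {n} {w = w} U = record { cover = cover′ ; unique = unique′ }
  where
    open Universal U

    cover′ : ∀ x → ∃ λ i → CoversAt (w ∘ mirror N) N n i x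
    cover′ x with cover (x ∘ mirror n)
    ... | i , cov = N ∸ (i + n) , coversAt-congʳ {w = w ∘ mirror N}
                                     (λ j<n → cong x (mirror-involutive j<n)) (coversAt-mirror {w = w} cov)

    unmirror : ∀ {i x} → CoversAt (w ∘ mirror N) N n i x → CoversAt w N n (N ∸ (i + n)) (x ∘ mirror n)
    unmirror cov = coversAt-congˡ {w = w ∘ mirror N ∘ mirror N}
                     (λ j<N → cong w (mirror-involutive j<N)) (coversAt-mirror {w = w ∘ mirror N} cov)

    unique′ : ∀ {x i i′} → CoversAt (w ∘ mirror N) N n i x → CoversAt (w ∘ mirror N) N n i′ x → i ≡ i′
    unique′ {i = i} {i′} cov cov′ =
      +-cancelʳ-≡ n i i′ (∸-cancelˡ-≡ (proj₁ cov) (proj₁ cov′) (unique (unmirror cov) (unmirror cov′)))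

record HoleBlock (w : ℕ → Maybe A) (N p k q : ℕ) : Set where
  field
    length≡ : N ≡ p + k + q
    prefix  : j < p → w j ≢ nothing
    holes   : j < k → w (p + j) ≡ nothing
    suffix  : j < q → w (p + k + j) ≢ nothing

holeBlock-mirror : ∀ {w : ℕ → Maybe A} → HoleBlock w N p k q → HoleBlock (w ∘ mirror N) N q k p
holeBlock-mirror {N = N} {p} {k} {q} {w} B = record
  { length≡ = N≡q+k+p
  ; prefix  = λ {j} j<q → suffix (mirror-< j<q) ∘ trans (cong w (sym (begin
      mirror N j             ≡⟨ cong (λ M → mirror M j) length≡ ⟩
      mirror (p + k + q) j   ≡⟨ mirror-+ (p + k) j<q ⟩
      p + k + mirror q j     ∎)))
  ; holes   = λ {j} j<k → trans (cong w (begin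
      mirror N (q + j)             ≡⟨ cong (λ M → mirror M (q + j)) (trans length≡ (+-assoc p k q)) ⟩
      mirror (p + (k + q)) (q + j) ≡⟨ mirror-+ p (subst (q + j <_) (+-comm q k) (+-monoʳ-< q j<k)) ⟩
      p + mirror (k + q) (q + j)   ≡⟨ cong (λ M → p + mirror M (q + j)) (+-comm k q) ⟩
      p + mirror (q + k) (q + j)   ≡⟨ cong (p +_) (mirror-cancelˡ q k j) ⟩
      p + mirror k j               ∎)) (holes (mirror-< j<k))
  ; suffix  = λ {j} j<p → prefix (mirror-< j<p) ∘ trans (cong w (sym (begin
      mirror N (q + k + j)           ≡⟨ cong (λ M → mirror M (q + k + j)) N≡q+k+p ⟩
      mirror (q + k + p) (q + k + j) ≡⟨ mirror-cancelˡ (q + k) p j ⟩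
      mirror p j                     ∎)))
  }
  where
    open HoleBlock B
    open ≡-Reasoning

    N≡q+k+p : N ≡ q + k + p
    N≡q+k+p = trans length≡ (trans (+-comm (p + k) q) (trans (cong (q +_) (+-comm p k)) (sym (+-assoc q k p))))

module NonUniversality {A : Set} (a₀ : A) (other : A → A) (other≢ : ∀ c → other c ≢ c) where

  avoid : Maybe A → A
  avoid (just c) = other c
  avoid nothing  = a₀   -- irrelevant: avoid is only applied at letter positions

  covers-avoid⇒hole : ∀ {l} → LetterCovers l (avoid l) → l ≡ nothing
  covers-avoid⇒hole {just c}  cov = ⊥-elim (other≢ c (sym (just-covers cov)))
  covers-avoid⇒hole {nothing} _   = refl

  probe : (ℕ → Maybe A) → ℕ → A → ℕ → A
  probe w b e zero    = avoid (w (pred b))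
  probe w b e (suc j) = fromMaybe e (w (b + j))

  early-probe⇒hole : ∀ {w : ℕ → Maybe A} {e} → Universal w N (suc m) →
    b + suc m ≤ N → w (b + m) ≡ nothing →
    CoversAt w N (suc m) i (probe w b e) → suc i + suc m ≤ N → w (pred b) ≡ nothing
  early-probe⇒hole {b = b} {i} {w} U b-bound last-hole cov next
    with refl ← tail-fits⇒next-window U b-bound last-hole (λ j _ → covers-fromMaybe (w (b + j))) cov next
    = covers-avoid⇒hole
        (subst (λ l → LetterCovers (w l) (avoid (w i))) (+-identityʳ i) (proj₂ cov 0 (s≤s z≤n)))

  letter-in-every-window⇒¬universal : ∀ {w : ℕ → Maybe A} → Universal w N n →
    t < n → N ≤ t + n → w t ≢ nothing → ⊥
  letter-in-every-window⇒¬universal {n = n} {t = t} {w} U t<n N≤t+n letter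
    with Universal.cover U (λ _ → avoid (w t))
  ... | i , bound , fits = letter (covers-avoid⇒hole
          (subst (λ l → LetterCovers (w l) (avoid (w t))) (m+[n∸m]≡n i≤t)
                 (fits (t ∸ i) (≤-<-trans (m∸n≤m t i) t<n))))
    where
      i≤t : i ≤ t
      i≤t = +-cancelʳ-≤ n i t (≤-trans bound N≤t+n)

  inner-window-ending-in-holes⇒¬universal : ∀ {w : ℕ → Maybe A} → Universal w N (2 + m) →
    b + (2 + m) ≤ N → w (b + m) ≡ nothing → w (b + suc m) ≡ nothing →
    w (pred b) ≢ nothing → w (pred N) ≢ nothing → ⊥
  inner-window-ending-in-holes⇒¬universal {N = N} {m} {b} {w} U bound penult-hole last-hole before last
    with Universal.cover U (probe w b (avoid (w (pred N))))
  ... | i , cov with m≤n⇒m<n∨m≡n (proj₁ cov)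
  ... | inj₁ next  = before (early-probe⇒hole U bound last-hole cov next)
  ... | inj₂ final = last (covers-avoid⇒hole
        (subst₂ LetterCovers (cong w i+1+m≡pred-N) (cong (fromMaybe _) penult-hole)
                (proj₂ cov (suc m) ≤-refl)))
    where
      i+1+m≡pred-N : i + suc m ≡ pred N
      i+1+m≡pred-N = trans (cong pred (sym (+-suc i (suc m)))) (cong pred final)

  last-window-ending-in-holes⇒¬universal : ∀ {w : ℕ → Maybe A} → Universal w N (2 + m) →
    b + (2 + m) ≡ N → w (b + m) ≡ nothing → w (b + suc m) ≡ nothing →
    (∀ {j} → j ≤ suc b → w j ≢ nothing) → ⊥
  last-window-ending-in-holes⇒¬universal {N = N} {m} {b} {w} U final penult-hole last-hole letter =
    alternation (letter (≤-trans pred[n]≤n (n≤1+n b))) (letter (n≤1+n b)) (letter ≤-refl)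
      (proj₁ (fits-last-window b ≤-refl last-hole)) (proj₂ (fits-last-window b ≤-refl last-hole))
      (proj₂ (fits-last-window (pred b) pred[n]≤n (pred-window-hole b penult-hole last-hole)))
    where
      fits-last-window : ∀ b′ → b′ ≤ b → w (b′ + suc m) ≡ nothing →
        LetterCovers (w b) (avoid (w (pred b′))) × LetterCovers (w (suc b)) (fromMaybe a₀ (w b′))
      fits-last-window b′ b′≤b b′-hole with Universal.cover U (probe w b′ a₀)
      ... | i , cov with m≤n⇒m<n∨m≡n (proj₁ cov)
      ... | inj₁ next = ⊥-elim (letter (≤-trans pred[n]≤n (≤-trans b′≤b (n≤1+n b)))
          (early-probe⇒hole U (≤-trans (+-monoˡ-≤ (2 + m) b′≤b) (≤-reflexive final)) b′-hole cov next))
      ... | inj₂ i+n≡N with refl ← +-cancelʳ-≡ (2 + m) i b (trans i+n≡N (sym final)) =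
        subst (λ l → LetterCovers (w l) _) (+-identityʳ b) (proj₂ cov 0 (s≤s z≤n)) ,
        subst₂ (λ l l′ → LetterCovers (w l) (fromMaybe a₀ (w l′))) (+-comm b 1) (+-identityʳ b′)
          (proj₂ cov 1 (s≤s (s≤s z≤n)))

      pred-window-hole : ∀ b → w (b + m) ≡ nothing → w (b + suc m) ≡ nothing →
                         w (pred b + suc m) ≡ nothing
      pred-window-hole zero    _       b+1+m-hole = b+1+m-hole
      pred-window-hole (suc b) b+m-hole _         = trans (cong w (+-suc b m)) b+m-hole

      -- The probe at b makes w b differ from w (b - 1) and w (b + 1) repeat w b; the probe at b - 1
      -- makes w (b + 1) repeat w (b - 1).
      alternation : ∀ {l₀ l₁ l₂ : Maybe A} → l₀ ≢ nothing → l₁ ≢ nothing → l₂ ≢ nothing →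
        LetterCovers l₁ (avoid l₀) → LetterCovers l₂ (fromMaybe a₀ l₁) →
        LetterCovers l₂ (fromMaybe a₀ l₀) → ⊥
      alternation {nothing} l₀-letter _ _ _ _ _ = l₀-letter refl
      alternation {_} {nothing} _ l₁-letter _ _ _ _ = l₁-letter refl
      alternation {_} {_} {nothing} _ _ l₂-letter _ _ _ = l₂-letter refl
      alternation {just α} {just β} {just γ} _ _ _ β≡other-α γ≡β γ≡α =
        other≢ α (trans (sym (just-covers β≡other-α)) (trans (sym (just-covers γ≡β)) (just-covers γ≡α)))

  window-ending-at-last-hole⇒¬universal : ∀ {w : ℕ → Maybe A} → HoleBlock w N p k q → Universal w N n →
    2 ≤ k → 2 + k ≤ n → n ≤ p + k → ⊥
  window-ending-at-last-hole⇒¬universal {N = N} {p} {k} {q} {n@(suc (suc m))} {w}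
    B U (s≤s (s≤s _)) 2+k≤n@(s≤s (s≤s _)) n≤p+k = on-side q length≡ suffix
    where
      open HoleBlock B
      b₀ : ℕ
      b₀ = p + k ∸ n

      b₀+n≡p+k : b₀ + n ≡ p + k
      b₀+n≡p+k = m∸n+n≡m n≤p+k

      penult-hole : w (b₀ + m) ≡ nothing
      penult-hole = trans (cong w (+-suc-cancel (+-suc-cancel b₀+n≡p+k))) (holes (n≤1+n _))

      last-hole : w (b₀ + suc m) ≡ nothing
      last-hole = trans (cong w (+-suc-cancel b₀+n≡p+k)) (holes ≤-refl)

      b₀<p : b₀ < p
      b₀<p = +-cancelʳ-< n b₀ p (subst (_< p + n) (sym b₀+n≡p+k) (+-monoʳ-< p (≤-trans (n≤1+n _) 2+k≤n)))

      2+b₀≤p : 2 + b₀ ≤ p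
      2+b₀≤p = +-cancelʳ-≤ k (2 + b₀) p (begin
        2 + b₀ + k     ≡⟨ sym (trans (+-suc b₀ (suc k)) (cong suc (+-suc b₀ k))) ⟩
        b₀ + (2 + k)   ≤⟨ +-monoʳ-≤ b₀ 2+k≤n ⟩
        b₀ + n         ≡⟨ b₀+n≡p+k ⟩
        p + k          ∎)
        where open ≤-Reasoning

      on-side : ∀ q → N ≡ p + k + q → (∀ {j} → j < q → w (p + k + j) ≢ nothing) → ⊥
      on-side zero N≡p+k+0 _ =
        last-window-ending-in-holes⇒¬universal U (trans b₀+n≡p+k (sym (trans N≡p+k+0 (+-identityʳ _))))
          penult-hole last-hole (λ j≤1+b₀ → prefix (≤-<-trans j≤1+b₀ 2+b₀≤p))
      on-side (suc q) N≡p+k+1+q letter =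
        inner-window-ending-in-holes⇒¬universal U
          (≤-trans (≤-reflexive b₀+n≡p+k) (≤-trans (m≤m+n _ (suc q)) (≤-reflexive (sym N≡p+k+1+q))))
          penult-hole last-hole (prefix (≤-<-trans pred[n]≤n b₀<p))
          (letter ≤-refl ∘ trans (cong w (sym (cong pred (trans N≡p+k+1+q (+-suc (p + k) q))))))

  letter-before-block⇒¬universal : ∀ {w : ℕ → Maybe A} → HoleBlock w N (suc p) k q → Universal w N n →
    suc p + k < n → q + k < n → ⊥
  letter-before-block⇒¬universal {N = N} {p} {k} {q} {n} B U 1+p+k<n q+k<n =
    letter-in-every-window⇒¬universal U (≤-trans (s≤s (m≤m+n p k)) (<⇒≤ 1+p+k<n)) N≤p+n (prefix ≤-refl)
    where
      open HoleBlock B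
      open ≤-Reasoning
      N≤p+n : N ≤ p + n
      N≤p+n = begin
        N                   ≡⟨ length≡ ⟩
        suc p + k + q       ≡⟨ cong suc (+-assoc p k q) ⟩
        suc (p + (k + q))   ≡⟨ sym (+-suc p (k + q)) ⟩
        p + suc (k + q)     ≤⟨ +-monoʳ-≤ p (subst (_< n) (+-comm q k) q+k<n) ⟩
        p + n               ∎

  holeBlock⇒¬universal : ∀ {w : ℕ → Maybe A} → HoleBlock w N p k q → Universal w N n →
    2 ≤ k → 2 + k ≤ n → ⊥
  holeBlock⇒¬universal {N = N} {p} {k} {q} {n} {w} B U 2≤k 2+k≤n with n ≤? p + k | n ≤? q + k
  ... | yes n≤p+k | _ = window-ending-at-last-hole⇒¬universal B U 2≤k 2+k≤n n≤p+k
  ... | no _ | yes n≤q+k =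
    window-ending-at-last-hole⇒¬universal (holeBlock-mirror B) (universal-mirror U) 2≤k 2+k≤n n≤q+k
  ... | no n≰p+k | no n≰q+k = short-sides p q B (≰⇒> n≰p+k) (≰⇒> n≰q+k)
    where
      short-sides : ∀ p q → HoleBlock w N p k q → p + k < n → q + k < n → ⊥
      short-sides (suc p) q B′ p+k<n q+k<n = letter-before-block⇒¬universal B′ U p+k<n q+k<n
      short-sides zero (suc q) B′ p+k<n q+k<n =
        letter-before-block⇒¬universal (holeBlock-mirror B′) (universal-mirror U) q+k<n p+k<n
      short-sides zero zero B′ k<n _ with Universal.cover U (λ _ → a₀)
      ... | i , bound , _ =
        <⇒≱ k<n (≤-trans (m≤n+m n i) (≤-trans bound (≤-reflexive (trans (HoleBlock.length≡ B′) (+-identityʳ k)))))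

-- Positions past the end read as ◇; CoversAt never inspects them.
at : List (Maybe A) → ℕ → Maybe A
at []       _       = nothing
at (l ∷ _)  zero    = l
at (_ ∷ ls) (suc j) = at ls j

prefixCovers⇒ : ∀ (ls : List (Maybe A)) x n → PrefixCovers ls (applyUpTo x n) →
                n ≤ length ls × (∀ j → j < n → LetterCovers (at ls j) (x j))
prefixCovers⇒ ls       x zero    _                = z≤n , λ _ ()
prefixCovers⇒ (l ∷ ls) x (suc n) (∷-cov cov covs) with prefixCovers⇒ ls (x ∘ suc) n covs
... | n≤len , fits = s≤s n≤len , λ where
  zero    _         → cov
  (suc j) (s≤s j<n) → fits j j<n

⇒prefixCovers : ∀ (ls : List (Maybe A)) x n → n ≤ length ls →
                (∀ j → j < n → LetterCovers (at ls j) (x j)) → PrefixCovers ls (applyUpTo x n)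
⇒prefixCovers ls       x zero    _           _    = []-cov
⇒prefixCovers (l ∷ ls) x (suc n) (s≤s n≤len) fits =
  ∷-cov (fits 0 (s≤s z≤n)) (⇒prefixCovers ls (x ∘ suc) n n≤len (λ j j<n → fits (suc j) (s≤s j<n)))

covers⇒coversAt : ∀ (w : PartialWord A) i x → Covers w i (applyUpTo x (suc m)) →
                  CoversAt (at w) (length w) (suc m) i x
covers⇒coversAt w       zero    x cov = prefixCovers⇒ w x _ cov
covers⇒coversAt (_ ∷ w) (suc i) x cov with covers⇒coversAt w i x cov
... | bound , fits = s≤s bound , fits

coversAt⇒covers : ∀ (w : PartialWord A) i x → CoversAt (at w) (length w) (suc m) i x →
                  Covers w i (applyUpTo x (suc m))
coversAt⇒covers w       zero    x (bound , fits) = ⇒prefixCovers w x _ bound fits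
coversAt⇒covers (_ ∷ w) (suc i) x (s≤s bound , fits) = coversAt⇒covers w i x (bound , fits)

isUniversal⇒Universal : ∀ {w : PartialWord A} → IsUniversal A (suc m) w →
                        Universal (at w) (length w) (suc m)
isUniversal⇒Universal {m = m} {w = w} U = record { cover = cover ; unique = unique }
  where
    cover : ∀ x → ∃ λ i → CoversAt (at w) (length w) (suc m) i x
    cover x with U (applyUpTo x (suc m)) (length-applyUpTo x (suc m))
    ... | i , cov , _ = i , covers⇒coversAt w i x cov

    unique : ∀ {x i i′} → CoversAt (at w) (length w) (suc m) i x →
             CoversAt (at w) (length w) (suc m) i′ x → i ≡ i′
    unique {x} {i} {i′} cov cov′ with U (applyUpTo x (suc m)) (length-applyUpTo x (suc m))
    ... | _ , _ , only =
      trans (only i (coversAt⇒covers w i x cov)) (sym (only i′ (coversAt⇒covers w i′ x cov′)))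

at-++ˡ : ∀ (xs : List (Maybe A)) {ys} → j < length xs → at (xs ++ ys) j ≡ at xs j
at-++ˡ {j = zero} (_ ∷ _)  _         = refl
at-++ˡ {j = suc j} (_ ∷ xs) (s≤s j<n) = at-++ˡ xs j<n

at-++ʳ : ∀ (xs : List (Maybe A)) {ys} → at (xs ++ ys) (length xs + j) ≡ at ys j
at-++ʳ []       = refl
at-++ʳ (_ ∷ xs) = at-++ʳ xs

at-fromWord : ∀ (u : List A) → j < length u → at (fromWord u) j ≢ nothing
at-fromWord {j = zero} (_ ∷ _)  _ ()
at-fromWord {j = suc j} (_ ∷ u) (s≤s j<n) = at-fromWord u j<n

at-replicate : ∀ k {l : Maybe A} → j < k → at (replicate k l) j ≡ l
at-replicate {j = zero} (suc k)  _         = refl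
at-replicate {j = suc j} (suc k) (s≤s j<k) = at-replicate k j<k

holeBlock-fromWord : ∀ (u v : List A) k →
  let w = fromWord u ++ replicate k hole ++ fromWord v in HoleBlock (at w) (length w) (length u) k (length v)
holeBlock-fromWord u v k = record
  { length≡ = begin
      length (fromWord u ++ block)        ≡⟨ length-++ (fromWord u) ⟩
      length (fromWord u) + length block  ≡⟨ cong₂ _+_ (length-map just u) (length-++ (replicate k hole)) ⟩
      length u + (length (replicate k hole) + length (fromWord v))
        ≡⟨ cong (length u +_) (cong₂ _+_ (length-replicate k) (length-map just v)) ⟩
      length u + (k + length v)           ≡⟨ sym (+-assoc (length u) k (length v)) ⟩
      length u + k + length v             ∎
  ; prefix  = λ j<|u| → at-fromWord u j<|u| ∘ trans (sym (at-++ˡ (fromWord u) (<-length-map u j<|u|)))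
  ; holes   = λ {j} j<k → begin
      at (fromWord u ++ block) (length u + j)    ≡⟨ after-u j ⟩
      at block j                                 ≡⟨ at-++ˡ (replicate k hole) (<-length-replicate j<k) ⟩
      at (replicate k hole) j                    ≡⟨ at-replicate k j<k ⟩
      hole                                       ∎
  ; suffix  = λ {j} j<|v| → at-fromWord v j<|v| ∘ trans (sym (begin
      at (fromWord u ++ block) (length u + k + j)    ≡⟨ cong (at (fromWord u ++ block)) (+-assoc (length u) k j) ⟩
      at (fromWord u ++ block) (length u + (k + j))  ≡⟨ after-u (k + j) ⟩
      at block (k + j)                               ≡⟨ cong (λ l → at block (l + j)) (sym (length-replicate k)) ⟩
      at block (length (replicate k hole) + j)       ≡⟨ at-++ʳ (replicate k hole) ⟩
      at (fromWord v) j                              ∎))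
  }
  where
    open ≡-Reasoning
    block = replicate k hole ++ fromWord v

    <-length-map : ∀ u → j < length u → j < length (fromWord u)
    <-length-map u = subst (_ <_) (sym (length-map just u))

    <-length-replicate : j < k → j < length (replicate k hole)
    <-length-replicate = subst (_ <_) (sym (length-replicate k))

    after-u : ∀ j → at (fromWord u ++ block) (length u + j) ≡ at block j
    after-u j = trans (cong (λ l → at (fromWord u ++ block) (l + j)) (sym (length-map just u)))
                      (at-++ʳ (fromWord u))

another : ∀ {a} → Fin (suc (suc a)) → Fin (suc (suc a))
another fzero    = fsuc fzero
another (fsuc _) = fzero

another≢ : ∀ {a} (c : Fin (suc (suc a))) → another c ≢ c
another≢ fzero    ()
another≢ (fsuc _) ()

theorem3p4 : (a n k : ℕ) → 2 ≤ a → 1 ≤ n → 2 ≤ k → 2 * k ≤ n →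
    (u v : List (Fin a)) →
    ¬ IsUniversal (Fin a) n (fromWord u ++ replicate k hole ++ fromWord v)
theorem3p4 (suc (suc a)) (suc m) k _ _ 2≤k 2k≤n u v universal =
  holeBlock⇒¬universal (holeBlock-fromWord u v k) (isUniversal⇒Universal universal) 2≤k 2+k≤n
  where
    open NonUniversality fzero another another≢
    open ≤-Reasoning
    2+k≤n : 2 + k ≤ suc m
    2+k≤n = begin
      2 + k       ≡⟨ +-comm 2 k ⟩
      k + 2       ≤⟨ +-monoʳ-≤ k 2≤k ⟩
      k + k       ≡⟨ cong (k +_) (sym (+-identityʳ k)) ⟩
      2 * k       ≤⟨ 2k≤n ⟩
      suc m       ∎
theorem3p4 (suc (suc a)) zero _ _ () _ _ _ _
theorem3p4 (suc zero)    _    _ (s≤s ()) _ _ _ _ _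
theorem3p4 zero          _    _ () _ _ _ _ _
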